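{- Let $S=(x,\iota(x),\tau(x,x'))$ be an array-based transition system satisfying the shape assumptions below and $\tilde S$ its parameter abstraction. Let $\mathcal{M}$ be a model of $A^E_I$. If $s,s'\models\tau(x,x')$, then for every state $\tilde s$ of $\tilde S$ with $(s,\tilde s)\in\mathcal{S}$, either (i) there exist a rule $\tilde\tau$ of $\tilde S$ and a state $\tilde s'$ such that $\tilde s,\tilde s'\models\tilde\tau$ and $(s',\tilde s')\in\mathcal{S}$; or (ii) there exist a rule $\tilde\tau$ of $\tilde S$ and states $\tilde s',\tilde s''$ such that $\tilde s,\tilde s'\models\tilde\tau_S$, $\tilde s',\tilde s''\models\tilde\tau$, and $(s',\tilde s'')\in\mathcal{S}$.
   Context: Fix an index theory $\mathcal{T}_I$ all of whose models have finite universes and a quantifier-free element theory $\mathcal{T}_E$; $A^E_I$ is their combination with an array theory whose only symbol $\cdot[\cdot]$ is function application (arrays denote total functions from the index universe to the element universe). $S=(x,\iota(x),\tau(x,x'))$ has a single array state variable $x$, and $\iota,\tau$ are formulas with quantified variables only of index sort; a state is a valuation of $x$ in a model of $A^E_I$, and transitions are evaluated in a fixed model. Shape assumptions: $\iota$ is universal, and $\tau$ is a finite disjunction of formulas $\exists I\forall J.\psi(I,J,x,x')$ with $\psi$ quantifier-free. Parameter abstraction: $P=(p_1,\dots,p_n)$ are fresh frozen index-sort variables (prophecy variables), $E=(e_1,\dots,e_m)$ fresh non-frozen index-sort variables (environmental variables), $m$ the largest length of an existential block among the disjuncts of $\tau$; values of $P\cup E$ are assumed pairwise different. $\tilde\iota(P,x)$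 expands every universal quantifier of $\iota$ as a conjunction over $P$. For each disjunct $\exists I\forall J.\psi$ of $\tau$ and each substitution $\sigma$ of $I$ by elements of $P\cup E$, the rule $\tilde\tau_\sigma$ is obtained by applying $\sigma$ to $\psi$ and expanding $\forall J$ as the conjunction of all instantiations of $J$ by elements of $P\cup E$. The stuttering transition is $\tilde\tau_S:=\bigwedge_{p\in P}(\tilde x'[p]=\tilde x[p]\wedge p'=p)$. $\tilde S=(\{\tilde x,P,E\},\tilde\iota,\tilde\tau)$ with $\tilde\tau$ the disjunction of $\tilde\tau_S$ and all rules $\tilde\tau_\sigma$; $\tilde x$ is a renaming of $x$, and a state $\tilde s$ of $\tilde S$ assigns $\tilde x$ and $P\cup E$ in a model of $A^E_I$. The relation $\mathcal{S}$: for states $s$ of $S$ and $\tilde s$ of $\tilde S$ in the same model $\mathcal{M}$, $(s,\tilde s)\in\mathcal{S}$ iff $\mathcal{M},s,\tilde s\models\bigwedge_{i=1}^n\tilde x[p_i]=x[p_i]$. -}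

module Defs where

open import Data.Nat using (ℕ; zero; suc; _⊔_; _+_)
open import Data.Fin using (Fin; zero; suc)
open import Data.Vec using (Vec; []; _∷_)
open import Data.List using (List; []; _∷_; map; concatMap; foldr; _++_; allFin)
open import Data.Product using (Σ; _×_; _,_; ∃)
open import Data.Sum using (_⊎_; inj₁; inj₂; [_,_])
open import Data.Unit using (⊤; tt)
open import Data.Empty using (⊥)
open import Relation.Binary.PropositionalEquality using (_≡_)
open import Function.Bundles using (_↔_)
open import Function.Definitions using (Injective)
import Data.Vec.Functional as VF

record Signature : Set₁ where
  field
    IFun : ℕ → Set
    IRel : ℕ → Set
    EFun : ℕ → Set
    ERel : ℕ → Set

-- Array-variable "stages": 'now' is the state variable x, 'next' is x'.
-- The same tag marks unprimed / primed index variables of the abstraction.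
data Stage : Set where
  now next : Stage

module _ (Sg : Signature) where
  open Signature Sg

  data ITerm (V : Set) : Set where
    var : V → ITerm V
    app : ∀ {k} → IFun k → Vec (ITerm V) k → ITerm V

  data ETerm (A V : Set) : Set where
    rd  : A → ITerm V → ETerm A V
    app : ∀ {k} → EFun k → Vec (ETerm A V) k → ETerm A V

  data QF (A V : Set) : Set where
    true false : QF A V
    eqI  : ITerm V → ITerm V → QF A V
    relI : ∀ {k} → IRel k → Vec (ITerm V) k → QF A V
    eqE  : ETerm A V → ETerm A V → QF A V
    relE : ∀ {k} → ERel k → Vec (ETerm A V) k → QF A V
    neg  : QF A V → QF A V
    and or : QF A V → QF A V → QF A V

  -- Pure element-sort quantifier-free formulas over element variables W
  -- (used to axiomatise the quantifier-free element theory T_E).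
  data ETm (W : Set) : Set where
    var : W → ETm W
    app : ∀ {k} → EFun k → Vec (ETm W) k → ETm W

  data EQF (W : Set) : Set where
    true false : EQF W
    eq   : ETm W → ETm W → EQF W
    rel  : ∀ {k} → ERel k → Vec (ETm W) k → EQF W
    neg  : EQF W → EQF W
    and or : EQF W → EQF W → EQF W

  mutual
    renI : ∀ {V W} → (V → W) → ITerm V → ITerm W
    renI g (var v)    = var (g v)
    renI g (app f ts) = app f (renIs g ts)

    renIs : ∀ {V W k} → (V → W) → Vec (ITerm V) k → Vec (ITerm W) k
    renIs g []       = []
    renIs g (t ∷ ts) = renI g t ∷ renIs g ts

  mutual
    renE : ∀ {A B V W} → (A → B) → (V → W) → ETerm A V → ETerm B W
    renE h g (rd a t)   = rd (h a) (renI g t)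
    renE h g (app f ts) = app f (renEs h g ts)

    renEs : ∀ {A B V W k} → (A → B) → (V → W) → Vec (ETerm A V) k → Vec (ETerm B W) k
    renEs h g []       = []
    renEs h g (t ∷ ts) = renE h g t ∷ renEs h g ts

  renQF : ∀ {A B V W} → (A → B) → (V → W) → QF A V → QF B W
  renQF h g true        = true
  renQF h g false       = false
  renQF h g (eqI t u)   = eqI (renI g t) (renI g u)
  renQF h g (relI r ts) = relI r (renIs g ts)
  renQF h g (eqE t u)   = eqE (renE h g t) (renE h g u)
  renQF h g (relE r ts) = relE r (renEs h g ts)
  renQF h g (neg φ)     = neg (renQF h g φ)
  renQF h g (and φ ψ)   = and (renQF h g φ) (renQF h g ψ)
  renQF h g (or φ ψ)    = or (renQF h g φ) (renQF h g ψ)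

  ⋀ : ∀ {A V} → List (QF A V) → QF A V
  ⋀ = foldr and true

  record IStr : Set₁ where
    field
      Ix   : Set
      ifun : ∀ {k} → IFun k → Vec Ix k → Ix
      irel : ∀ {k} → IRel k → Vec Ix k → Set

  record EStr : Set₁ where
    field
      El   : Set
      efun : ∀ {k} → EFun k → Vec El k → El
      erel : ∀ {k} → ERel k → Vec El k → Set

  IndexTheory : Set₂
  IndexTheory = IStr → Set₁

  -- A quantifier-free element theory: a family of quantifier-free axioms
  -- (each read as its universal closure).
  record ElementTheory : Set₁ where
    field
      Ax    : Set
      arity : Ax → ℕ
      axiom : (a : Ax) → EQF (Fin (arity a))

  module _ (Em : EStr) where
    open EStr Em
    mutual
      evETm : ∀ {W} → (W → El) → ETm W → El
      evETm ρ (var w)    = ρ w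
      evETm ρ (app f ts) = efun f (evETms ρ ts)

      evETms : ∀ {W k} → (W → El) → Vec (ETm W) k → Vec El k
      evETms ρ []       = []
      evETms ρ (t ∷ ts) = evETm ρ t ∷ evETms ρ ts

    evEQF : ∀ {W} → (W → El) → EQF W → Set
    evEQF ρ true       = ⊤
    evEQF ρ false      = ⊥
    evEQF ρ (eq t u)   = evETm ρ t ≡ evETm ρ u
    evEQF ρ (rel r ts) = erel r (evETms ρ ts)
    evEQF ρ (neg φ)    = evEQF ρ φ → ⊥
    evEQF ρ (and φ ψ)  = evEQF ρ φ × evEQF ρ ψ
    evEQF ρ (or φ ψ)   = evEQF ρ φ ⊎ evEQF ρ ψ

  _⊨E_ : EStr → ElementTheory → Set
  Em ⊨E TE = (a : ElementTheory.Ax TE) (ρ : Fin (ElementTheory.arity TE a) → EStr.El Em) →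
             evEQF Em ρ (ElementTheory.axiom TE a)

  Finite : Set → Set
  Finite X = Σ ℕ λ k → X ↔ Fin k

  AllModelsFinite : IndexTheory → Set₁
  AllModelsFinite TI = (Im : IStr) → TI Im → Finite (IStr.Ix Im)

  -- A model of A^E_I: a model of T_I, a model of T_E; the array sort is
  -- interpreted as all total functions Ix → El (built into 'Array').
  record Model (TI : IndexTheory) (TE : ElementTheory) : Set₂ where
    field
      Im   : IStr
      Em   : EStr
      Im⊨  : TI Im
      Em⊨  : Em ⊨E TE

  module _ {TI : IndexTheory} {TE : ElementTheory} (M : Model TI TE) where
    open Model M
    open IStr Im
    open EStr Em

    Array : Set
    Array = Ix → El

    mutual
      evI : ∀ {V} → (V → Ix) → ITerm V → Ix
      evI ρ (var v)    = ρ v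
      evI ρ (app f ts) = ifun f (evIs ρ ts)

      evIs : ∀ {V k} → (V → Ix) → Vec (ITerm V) k → Vec Ix k
      evIs ρ []       = []
      evIs ρ (t ∷ ts) = evI ρ t ∷ evIs ρ ts

    mutual
      evE : ∀ {A V} → (A → Array) → (V → Ix) → ETerm A V → El
      evE α ρ (rd a t)   = α a (evI ρ t)
      evE α ρ (app f ts) = efun f (evEs α ρ ts)

      evEs : ∀ {A V k} → (A → Array) → (V → Ix) → Vec (ETerm A V) k → Vec El k
      evEs α ρ []       = []
      evEs α ρ (t ∷ ts) = evE α ρ t ∷ evEs α ρ ts

    ⟦_⟧ : ∀ {A V} → QF A V → (A → Array) → (V → Ix) → Set
    ⟦ true ⟧      α ρ = ⊤
    ⟦ false ⟧     α ρ = ⊥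
    ⟦ eqI t u ⟧   α ρ = evI ρ t ≡ evI ρ u
    ⟦ relI r ts ⟧ α ρ = irel r (evIs ρ ts)
    ⟦ eqE t u ⟧   α ρ = evE α ρ t ≡ evE α ρ u
    ⟦ relE r ts ⟧ α ρ = erel r (evEs α ρ ts)
    ⟦ neg φ ⟧     α ρ = ⟦ φ ⟧ α ρ → ⊥
    ⟦ and φ ψ ⟧   α ρ = ⟦ φ ⟧ α ρ × ⟦ ψ ⟧ α ρ
    ⟦ or φ ψ ⟧    α ρ = ⟦ φ ⟧ α ρ ⊎ ⟦ ψ ⟧ α ρ

  -- ι = ∀ J. φ(J, x) with φ quantifier-free (only array variable: x).
  record Universal : Set where
    field
      nJ   : ℕ
      body : QF ⊤ (Fin nJ)

  -- a disjunct ∃ I ∀ J. ψ(I, J, x, x') of τ (arrays: now = x, next = x')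
  record Disjunct : Set where
    field
      nI   : ℕ
      nJ   : ℕ
      body : QF Stage (Fin nI ⊎ Fin nJ)

  record ATS : Set where
    field
      init  : Universal
      trans : List Disjunct       -- τ is the disjunction of these

  module _ {TI : IndexTheory} {TE : ElementTheory} (M : Model TI TE) where
    open Model M
    open IStr Im

    State : Set
    State = Array M

    stages : State → State → Stage → Array M
    stages s s' now  = s
    stages s s' next = s'

    _,_⊨D_ : State → State → Disjunct → Set
    s , s' ⊨D d = ∃ λ (a : Fin (Disjunct.nI d) → Ix) → (b : Fin (Disjunct.nJ d) → Ix) →
                  ⟦ M ⟧ (Disjunct.body d) (stages s s') [ a , b ]

    _,_⊨τ_ : State → State → ATS → Set
    s , s' ⊨τ S = Σ Disjunct λ d → (d ∈L ATS.trans S) × (s , s' ⊨D d)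
      where
      open import Data.List.Membership.Propositional renaming (_∈_ to _∈L_)

  maxEx : ATS → ℕ
  maxEx S = foldr (λ d r → Disjunct.nI d ⊔ r) 0 (ATS.trans S)

  -- parameter variables P ∪ E: inj₁ i is p_i, inj₂ j is e_j
  Par : ℕ → ℕ → Set
  Par n m = Fin n ⊎ Fin m

  allPar : (n m : ℕ) → List (Par n m)
  allPar n m = map inj₁ (allFin n) ++ map inj₂ (allFin m)

  allFuns : ∀ {X : Set} → List X → (l : ℕ) → List (Fin l → X)
  allFuns xs zero    = (λ ()) ∷ []
  allFuns xs (suc l) = concatMap (λ f → map (λ a → a VF.∷ f) xs) (allFuns xs l)

  AbsIx : ℕ → ℕ → Set
  AbsIx n m = Stage × Par n m

  AForm : ℕ → ℕ → Set
  AForm n m = QF Stage (AbsIx n m)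

  cur : ∀ {n m} → Par n m → AbsIx n m
  cur v = now , v

  module _ (S : ATS) (n : ℕ) where
    private
      m = maxEx S

    -- ι̃(P, x̃): universal quantifiers expanded as conjunction over P
    ιt : AForm n m
    ιt = ⋀ (map (λ ρ → renQF (λ _ → now) (λ j → now , inj₁ (ρ j)) (Universal.body (ATS.init S)))
                (allFuns (allFin n) (Universal.nJ (ATS.init S))))

    τσ : (d : Disjunct) → (Fin (Disjunct.nI d) → Par n m) → AForm n m
    τσ d σ = ⋀ (map (λ ρ → renQF (λ a → a) (λ v → cur ([ σ , ρ ] v)) (Disjunct.body d))
                    (allFuns (allPar n m) (Disjunct.nJ d)))

    rules : List (AForm n m)
    rules = concatMap (λ d → map (τσ d) (allFuns (allPar n m) (Disjunct.nI d))) (ATS.trans S)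

    τS : AForm n m
    τS = ⋀ (map (λ i → and (eqE (rd next (var (next , inj₁ i))) (rd now (var (now , inj₁ i))))
                           (eqI (var (next , inj₁ i)) (var (now , inj₁ i))))
                (allFin n))

    τt : AForm n m
    τt = or τS (foldr or false rules)

    module _ {TI : IndexTheory} {TE : ElementTheory} (M : Model TI TE) where
      open Model M
      open IStr Im

      record AState : Set where
        field
          xt   : Array M
          val  : Par n m → Ix
          dist : Injective _≡_ _≡_ val

      open AState

      -- s̃, s̃' ⊨ φ for a transition formula of S̃; P is frozen, so its
      -- values are required to be unchanged along every transition.
      _,_⊨_ : AState → AState → AForm n m → Set
      st , st' ⊨ φ = ((i : Fin n) → val st' (inj₁ i) ≡ val st (inj₁ i)) ×
                     ⟦ M ⟧ φ (stages M (xt st) (xt st')) ρ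
        where
        ρ : AbsIx n m → Ix
        ρ (now  , v) = val st v
        ρ (next , v) = val st' v

      Sim : State M → AState → Set
      Sim s st = (i : Fin n) → xt st (val st (inj₁ i)) ≡ s (val st (inj₁ i))

{-# OPTIONS --safe #-}
module Submission where

-- The concrete step fires a disjunct ∃I∀J.ψ with witnesses a : I → Ix, and option (ii) always
-- applies. The stuttering step fixes P and x̃[P] only, so it may set x̃ := s and re-assign the
-- environmental variables so that every witness a k is the value of some parameter σ k (a
-- `Covering`): a witness that is not yet a parameter value takes an environmental slot unused
-- by the other witnesses, which exists because |I| ≤ m. From there the rule τ̃_σ reaches
-- x̃ := s′, as each of its conjuncts is ψ with I at a and J at parameter values. Finiteness of
-- the index universe is needed only to decide equality of indices.

open import Defs
open import Data.Empty using (⊥; ⊥-elim)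
open import Data.Fin using (Fin; zero; suc; fromℕ<; _≟_)
open import Data.Fin.Properties using (any?; ¬∀⟶∃¬; <⇒notInjective; inj⇒≟)
open import Data.List using (List; []; _∷_; map; foldr; allFin)
open import Data.List.Membership.Propositional using (_∈_)
open import Data.List.Membership.Propositional.Properties
  using (∈-map⁺; ∈-concatMap⁺; ∈-++⁺ˡ; ∈-++⁺ʳ; ∈-allFin)
open import Data.List.Relation.Unary.Any using (here; there)
import Data.List.Relation.Unary.Any as Any
open import Data.Nat using (ℕ; zero; suc; _≤_; _<_; _⊔_; z≤n)
open import Data.Nat.Properties using (≤-trans; n≤1+n; m≤m⊔n; m≤n⇒m≤o⊔n)
open import Data.Product using (Σ; _×_; _,_; proj₁; proj₂; ∃)
import Data.Product as Product
open import Data.Sum using (_⊎_; inj₁; inj₂; [_,_])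
import Data.Sum.Properties as Sum
open import Data.Unit using (tt)
open import Data.Vec using (Vec; []; _∷_)
open import Data.Vec.Functional using (updateAt)
import Data.Vec.Functional as Vector
open import Data.Vec.Functional.Properties using (updateAt-updates; updateAt-minimal)
open import Function using (_∘_; id; const)
open import Function.Bundles using (_↔_)
open import Function.Definitions using (Injective)
open import Function.Properties.Inverse using (↔⇒↣)
open import Relation.Nullary using (¬_; yes; no; Dec; map′; _⊎-dec_)
open import Relation.Binary.Definitions using (DecidableEquality)
open import Relation.Binary.PropositionalEquality
  using (_≡_; _≢_; refl; sym; trans; cong; cong₂; subst; _≗_; module ≡-Reasoning)

finite⇒≟ : ∀ {X : Set} → (Σ ℕ λ k → X ↔ Fin k) → DecidableEquality X
finite⇒≟ (_ , X↔Fin) = inj⇒≟ (↔⇒↣ X↔Fin)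

<⇒∃-missed : ∀ {l m} → l < m → (f : Fin l → Fin m) → ∃ λ j → ∀ k → f k ≢ j
<⇒∃-missed {m = m} l<m f =
  Product.map₂ (λ unhit k f[k]≡j → unhit (k , f[k]≡j))
    (¬∀⟶∃¬ m (λ j → ∃ λ k → f k ≡ j) (λ j → any? (λ k → f k ≟ j)) ¬surjective)
  where
  ¬surjective : ¬ (∀ j → ∃ λ k → f k ≡ j)
  ¬surjective hit = <⇒notInjective l<m λ {i} {j} e →
    trans (sym (proj₂ (hit i))) (trans (cong f e) (proj₂ (hit j)))

injective-override : ∀ {A X : Set} → DecidableEquality A →
                     {f h : A → X} {q : A} {x : X} →
                     Injective _≡_ _≡_ f → (∀ p → f p ≢ x) →
                     (∀ p → p ≢ q → h p ≡ f p) → h q ≡ x → Injective _≡_ _≡_ h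
injective-override _≟A_ {q = q} f-inj fresh h-off h-at {p} {p′} e with p ≟A q | p′ ≟A q
... | yes p≡q  | yes p′≡q = trans p≡q (sym p′≡q)
... | yes refl | no p′≢q  = ⊥-elim (fresh p′ (trans (sym (h-off p′ p′≢q)) (trans (sym e) h-at)))
... | no p≢q   | yes refl = ⊥-elim (fresh p (trans (sym (h-off p p≢q)) (trans e h-at)))
... | no p≢q   | no p′≢q  = f-inj (trans (sym (h-off p p≢q)) (trans e (h-off p′ p′≢q)))

injective-[∘inj₁,∘inj₂] : ∀ {A B X : Set} {f : A ⊎ B → X} →
                          Injective _≡_ _≡_ f → Injective _≡_ _≡_ [ f ∘ inj₁ , f ∘ inj₂ ]
injective-[∘inj₁,∘inj₂] f-inj {inj₁ _} {inj₁ _} = f-inj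
injective-[∘inj₁,∘inj₂] f-inj {inj₁ _} {inj₂ _} = f-inj
injective-[∘inj₁,∘inj₂] f-inj {inj₂ _} {inj₁ _} = f-inj
injective-[∘inj₁,∘inj₂] f-inj {inj₂ _} {inj₂ _} = f-inj

record Covering {X : Set} {n} (m : ℕ) (fixed : Fin n → X) {l} (a : Fin l → X) : Set where
  field
    env       : Fin m → X
    injective : Injective _≡_ _≡_ [ fixed , env ]
    slot      : Fin l → Fin n ⊎ Fin m
    covers    : ∀ k → [ fixed , env ] (slot k) ≡ a k

module _ {X : Set} (_≟X_ : DecidableEquality X) {n m : ℕ} (fixed : Fin n → X) where

  inRange? : (w : Fin n ⊎ Fin m → X) (x : X) → Dec (∃ λ p → w p ≡ x)
  inRange? w x = map′
    [ (λ (i , e) → inj₁ i , e) , (λ (j , e) → inj₂ j , e) ]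
    (λ { (inj₁ i , e) → inj₁ (i , e) ; (inj₂ j , e) → inj₂ (j , e) })
    (any? (λ i → w (inj₁ i) ≟X x) ⊎-dec any? (λ j → w (inj₂ j) ≟X x))

  covering-suc : ∀ {l} → suc l ≤ m → (a : Fin (suc l) → X) →
                 Covering m fixed (a ∘ suc) → Covering m fixed a
  covering-suc l<m a c with inRange? [ fixed , Covering.env c ] (a zero)
  ... | yes (p , p↦a₀) = record
    { env       = env
    ; injective = injective
    ; slot      = p Vector.∷ slot
    ; covers    = λ { zero → p↦a₀ ; (suc k) → covers k }
    }
    where open Covering c
  ... | no a₀∉range = record
    { env       = env′
    ; injective = injective-override (Sum.≡-dec _≟_ _≟_) injective (λ p e → a₀∉range (p , e))
                    off-j (updateAt-updates j env)
    ; slot      = inj₂ j Vector.∷ slot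
    ; covers    = λ { zero → updateAt-updates j env
                    ; (suc k) → trans (off-j (slot k) (slot-misses-j k)) (covers k) }
    }
    where
    open Covering c
    -- Only the environmental slots in use matter; parameters in P go to an arbitrary one.
    envSlot : Fin n ⊎ Fin m → Fin m
    envSlot = [ const (fromℕ< l<m) , id ]
    j : Fin m
    j = proj₁ (<⇒∃-missed l<m (envSlot ∘ slot))
    slot-misses-j : ∀ k → slot k ≢ inj₂ j
    slot-misses-j k e = proj₂ (<⇒∃-missed l<m (envSlot ∘ slot)) k (cong envSlot e)
    env′ : Fin m → X
    env′ = updateAt env j (const (a zero))
    off-j : ∀ p → p ≢ inj₂ j → [ fixed , env′ ] p ≡ [ fixed , env ] p
    off-j (inj₁ i) _   = refl
    off-j (inj₂ k) k≢j = updateAt-minimal k j env (k≢j ∘ cong inj₂)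

  covering : ∀ {l} {env₀ : Fin m → X} → Injective _≡_ _≡_ [ fixed , env₀ ] → l ≤ m →
             (a : Fin l → X) → Covering m fixed a
  covering {env₀ = env₀} inj z≤n a =
    record { env = env₀ ; injective = inj ; slot = λ () ; covers = λ () }
  covering {suc l} inj l<m a =
    covering-suc l<m a (covering inj (≤-trans (n≤1+n l) l<m) (a ∘ suc))

module _ {Sg : Signature} {TI : IndexTheory Sg} {TE : ElementTheory Sg} (M : Model Sg TI TE) where
  open Model M using (Im; Em)
  open IStr Im using (Ix; ifun; irel)
  open EStr Em using (efun; erel)

  mutual
    evI-renI : ∀ {V W} (h : V → W) {ρ : W → Ix} {ρ′ : V → Ix} → ρ ∘ h ≗ ρ′ →
               ∀ t → evI Sg M ρ (renI Sg h t) ≡ evI Sg M ρ′ t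
    evI-renI h ρ∘h≗ρ′ (var v)    = ρ∘h≗ρ′ v
    evI-renI h ρ∘h≗ρ′ (app f ts) = cong (ifun f) (evIs-renIs h ρ∘h≗ρ′ ts)

    evIs-renIs : ∀ {V W k} (h : V → W) {ρ : W → Ix} {ρ′ : V → Ix} → ρ ∘ h ≗ ρ′ →
                 ∀ (ts : Vec (ITerm Sg V) k) → evIs Sg M ρ (renIs Sg h ts) ≡ evIs Sg M ρ′ ts
    evIs-renIs h ρ∘h≗ρ′ []       = refl
    evIs-renIs h ρ∘h≗ρ′ (t ∷ ts) = cong₂ _∷_ (evI-renI h ρ∘h≗ρ′ t) (evIs-renIs h ρ∘h≗ρ′ ts)

  mutual
    evE-renE : ∀ {A V W} (α : A → Array Sg M) (h : V → W) {ρ : W → Ix} {ρ′ : V → Ix} →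
               ρ ∘ h ≗ ρ′ → ∀ t → evE Sg M α ρ (renE Sg id h t) ≡ evE Sg M α ρ′ t
    evE-renE α h ρ∘h≗ρ′ (rd a t)   = cong (α a) (evI-renI h ρ∘h≗ρ′ t)
    evE-renE α h ρ∘h≗ρ′ (app f ts) = cong (efun f) (evEs-renEs α h ρ∘h≗ρ′ ts)

    evEs-renEs : ∀ {A V W k} (α : A → Array Sg M) (h : V → W) {ρ : W → Ix} {ρ′ : V → Ix} →
                 ρ ∘ h ≗ ρ′ → ∀ (ts : Vec (ETerm Sg A V) k) →
                 evEs Sg M α ρ (renEs Sg id h ts) ≡ evEs Sg M α ρ′ ts
    evEs-renEs α h ρ∘h≗ρ′ []       = refl
    evEs-renEs α h ρ∘h≗ρ′ (t ∷ ts) = cong₂ _∷_ (evE-renE α h ρ∘h≗ρ′ t) (evEs-renEs α h ρ∘h≗ρ′ ts)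

  ⟦renQF⟧ : ∀ {A V W} (α : A → Array Sg M) (h : V → W) {ρ : W → Ix} {ρ′ : V → Ix} →
            ρ ∘ h ≗ ρ′ → ∀ φ → ⟦_⟧ Sg M (renQF Sg id h φ) α ρ ≡ ⟦_⟧ Sg M φ α ρ′
  ⟦renQF⟧ α h ρ∘h≗ρ′ true        = refl
  ⟦renQF⟧ α h ρ∘h≗ρ′ false       = refl
  ⟦renQF⟧ α h ρ∘h≗ρ′ (eqI t u)   = cong₂ _≡_ (evI-renI h ρ∘h≗ρ′ t) (evI-renI h ρ∘h≗ρ′ u)
  ⟦renQF⟧ α h ρ∘h≗ρ′ (relI r ts) = cong (irel r) (evIs-renIs h ρ∘h≗ρ′ ts)
  ⟦renQF⟧ α h ρ∘h≗ρ′ (eqE t u)   = cong₂ _≡_ (evE-renE α h ρ∘h≗ρ′ t) (evE-renE α h ρ∘h≗ρ′ u)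
  ⟦renQF⟧ α h ρ∘h≗ρ′ (relE r ts) = cong (erel r) (evEs-renEs α h ρ∘h≗ρ′ ts)
  ⟦renQF⟧ α h ρ∘h≗ρ′ (neg φ)     = cong (λ P → P → ⊥) (⟦renQF⟧ α h ρ∘h≗ρ′ φ)
  ⟦renQF⟧ α h ρ∘h≗ρ′ (and φ ψ)   = cong₂ _×_ (⟦renQF⟧ α h ρ∘h≗ρ′ φ) (⟦renQF⟧ α h ρ∘h≗ρ′ ψ)
  ⟦renQF⟧ α h ρ∘h≗ρ′ (or φ ψ)    = cong₂ _⊎_ (⟦renQF⟧ α h ρ∘h≗ρ′ φ) (⟦renQF⟧ α h ρ∘h≗ρ′ ψ)

  ⟦⋀-map⟧ : ∀ {A V B : Set} (F : B → QF Sg A V) {α ρ} (xs : List B) →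
            (∀ x → ⟦_⟧ Sg M (F x) α ρ) → ⟦_⟧ Sg M (⋀ Sg (map F xs)) α ρ
  ⟦⋀-map⟧ F []       all = tt
  ⟦⋀-map⟧ F (x ∷ xs) all = all x , ⟦⋀-map⟧ F xs all

module _ (Sg : Signature) where

  allFuns-complete : ∀ {X : Set} (xs : List X) {l} (f : Fin l → X) → (∀ i → f i ∈ xs) →
                     ∃ λ g → g ∈ allFuns Sg xs l × g ≗ f
  allFuns-complete xs {zero}  f f∈xs = (λ ()) , here refl , λ ()
  allFuns-complete xs {suc l} f f∈xs with allFuns-complete xs (f ∘ suc) (f∈xs ∘ suc)
  ... | g , g∈ , g≗f∘suc = (f zero Vector.∷ g) , f₀∷g∈ , λ { zero → refl ; (suc i) → g≗f∘suc i }
    where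
    f₀∷g∈ : (f zero Vector.∷ g) ∈ allFuns Sg xs (suc l)
    f₀∷g∈ = ∈-concatMap⁺ _ (Any.map (λ { refl → ∈-map⁺ (Vector._∷ g) (f∈xs zero) }) g∈)

  allPar-complete : ∀ n m (p : Par Sg n m) → p ∈ allPar Sg n m
  allPar-complete n m (inj₁ i) = ∈-++⁺ˡ (∈-map⁺ inj₁ (∈-allFin i))
  allPar-complete n m (inj₂ j) = ∈-++⁺ʳ (map inj₁ (allFin n)) (∈-map⁺ inj₂ (∈-allFin j))

  nI≤maxEx : ∀ {ds : List (Disjunct Sg)} {d} → d ∈ ds →
             Disjunct.nI d ≤ foldr (λ d r → Disjunct.nI d ⊔ r) 0 ds
  nI≤maxEx {d ∷ _}  (here refl) = m≤m⊔n (Disjunct.nI d) _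
  nI≤maxEx {d′ ∷ _} (there d∈)  = m≤n⇒m≤o⊔n (Disjunct.nI d′) (nI≤maxEx d∈)

module _ {Sg : Signature} (S : ATS Sg) (n : ℕ) where
  private
    m = maxEx Sg S

  τσ∈rules : ∀ {d} → d ∈ ATS.trans S → (σ : Fin (Disjunct.nI d) → Par Sg n m) →
             ∃ λ σ′ → σ′ ≗ σ × τσ Sg S n d σ′ ∈ rules Sg S n
  τσ∈rules {d} d∈ σ with allFuns-complete Sg (allPar Sg n m) σ (allPar-complete Sg n m ∘ σ)
  ... | σ′ , σ′∈ , σ′≗σ =
    σ′ , σ′≗σ , ∈-concatMap⁺ _ (Any.map (λ { refl → ∈-map⁺ (τσ Sg S n d) σ′∈ }) d∈)

  module _ {TI : IndexTheory Sg} {TE : ElementTheory Sg} (M : Model Sg TI TE) where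
    open AState

    FreezesP : AState Sg S n M → AState Sg S n M → Set
    FreezesP st st′ = ∀ i → val st′ (inj₁ i) ≡ val st (inj₁ i)

    Sim⇒τS : ∀ s st st′ → Sim Sg S n M s st → Sim Sg S n M s st′ → FreezesP st st′ →
             _,_⊨_ Sg S n M st st′ (τS Sg S n)
    Sim⇒τS s st st′ sim sim′ frozen = frozen , ⟦⋀-map⟧ M _ (allFin n) λ i → xt-agrees i , frozen i
      where
      open ≡-Reasoning
      xt-agrees : ∀ i → xt st′ (val st′ (inj₁ i)) ≡ xt st (val st (inj₁ i))
      xt-agrees i = begin
        xt st′ (val st′ (inj₁ i)) ≡⟨ sim′ i ⟩
        s (val st′ (inj₁ i))      ≡⟨ cong s (frozen i) ⟩
        s (val st (inj₁ i))       ≡⟨ sim i ⟨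
        xt st (val st (inj₁ i))   ∎

    ⊨D⇒τσ : ∀ {d} (σ : Fin (Disjunct.nI d) → Par Sg n m) {a} st st′ → val st ∘ σ ≗ a →
            (∀ b → ⟦_⟧ Sg M (Disjunct.body d) (stages Sg M (xt st) (xt st′)) [ a , b ]) →
            FreezesP st st′ → _,_⊨_ Sg S n M st st′ (τσ Sg S n d σ)
    ⊨D⇒τσ {d} σ {a} st st′ σ-names-a holds frozen =
      frozen , ⟦⋀-map⟧ M _ (allFuns Sg (allPar Sg n m) (Disjunct.nJ d)) λ ρ →
        subst id (sym (⟦renQF⟧ M _ _ (instance≗ ρ) (Disjunct.body d))) (holds (val st ∘ ρ))
      where
      instance≗ : ∀ ρ (v : Fin (Disjunct.nI d) ⊎ Fin (Disjunct.nJ d)) →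
                  val st ([ σ , ρ ] v) ≡ [ a , val st ∘ ρ ] v
      instance≗ ρ (inj₁ k) = σ-names-a k
      instance≗ ρ (inj₂ j) = refl

mainTheorem8 :
  (Sg : Signature) (TI : IndexTheory Sg) (TE : ElementTheory Sg) →
  AllModelsFinite Sg TI →
  (S : ATS Sg) (n : ℕ) (M : Model Sg TI TE) →
  (s s' : State Sg M) → _,_⊨τ_ Sg M s s' S →
  (st : AState Sg S n M) → Sim Sg S n M s st →
  (Σ (AForm Sg n (maxEx Sg S)) λ τ → τ ∈ rules Sg S n ×
     Σ (AState Sg S n M) λ st' →
       _,_⊨_ Sg S n M st st' τ × Sim Sg S n M s' st')
  ⊎
  (Σ (AForm Sg n (maxEx Sg S)) λ τ → τ ∈ rules Sg S n ×
     Σ (AState Sg S n M) λ st' → Σ (AState Sg S n M) λ st'' →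
       _,_⊨_ Sg S n M st st' (τS Sg S n) × _,_⊨_ Sg S n M st' st'' τ ×
       Sim Sg S n M s' st'')
mainTheorem8 Sg TI TE finite S n M s s′ (d , d∈ , a , holds) st sim =
  let σ , σ≗slot , τσ∈ = τσ∈rules S n d∈ slot in
  inj₂ ( τσ Sg S n d σ , τσ∈ , at s , at s′
       , Sim⇒τS S n M s st (at s) sim (λ _ → refl) (λ _ → refl)
       , ⊨D⇒τσ S n M σ (at s) (at s′) (λ k → trans (cong val′ (σ≗slot k)) (covers k))
               holds (λ _ → refl)
       , λ _ → refl )
  where
  open AState
  open Covering (covering (finite⇒≟ (finite (Model.Im M) (Model.Im⊨ M))) (val st ∘ inj₁)
                   (injective-[∘inj₁,∘inj₂] (dist st)) (nI≤maxEx Sg d∈) a)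
  val′ : Par Sg n (maxEx Sg S) → IStr.Ix (Model.Im M)
  val′ = [ val st ∘ inj₁ , env ]
  at : Array Sg M → AState Sg S n M
  at x = record { xt = x ; val = val′ ; dist = injective }
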